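{- $\mathbb{P}(\mathbb{P}(G_3))=\mathbb{P}(G_3)$; that is, for every $\Gamma\subseteq For$, the consequence set of $\Gamma$ in the paraconsistentization of $\mathbb{P}(G_3)$ equals $Cn^{\mathbb{P}}_{G_3}(\Gamma)$.
   Context: $For$ is the set of formulas built from a countable set $Prop$ of propositional letters with $\neg,\vee,\wedge,\rightarrow$. $G_3$ (Gödel) is given by the matrix with truth values $\{0,1/2,1\}$, designated set $\{1\}$, $f_\neg(0)=1$ and $f_\neg(x)=0$ for $x\neq 0$, $f_\vee=\max$, $f_\wedge=\min$, $f_\rightarrow(x,y)=1$ if $x\le y$ and $=y$ if $x>y$; valuations are maps $Prop\to\{0,1/2,1\}$ extended via these functions. $\Gamma\vDash_{G_3}\alpha$ iff every valuation giving all members of $\Gamma$ value $1$ gives $\alpha$ value $1$; $Cn_{G_3}(\Gamma)=\{\alpha:\Gamma\vDash_{G_3}\alpha\}$. For a consequence structure $L=\langle X,Cn_L\rangle$ ($X$ nonempty, $Cn_L:\wp(X)\to\wp(X)$ any map), $\Gamma\subseteq X$ is $L$-consistent iff $Cn_L(\Gamma)\neq X$, and $\mathbb{P}(L)=\langle X,Cn^{\mathbb{P}}_L\rangle$ with $Cn^{\mathbb{P}}_L(\Gamma)=\bigcup\{Cn_L(\Gamma'):\Gamma'\subseteq\Gamma,\ \Gamma'\ L\text{ -consistent}\}$. $\mathbb{P}(G_3)$ is the paraconsistentization of $\langle For,Cn_{G_3}\rangle$ and $\mathbb{P}(\mathbb{P}(G_3))$ that of $\mathbb{P}(G_3)$.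 -}

module Defs where

open import Level using (Level; _⊔_; 0ℓ) renaming (suc to lsuc)
open import Data.Nat using (ℕ)
open import Data.Product using (Σ; _×_; _,_)
open import Relation.Nullary using (¬_)
open import Relation.Unary using (Pred; _⊆_)
open import Relation.Binary.PropositionalEquality using (_≡_)

-- Subsets of X are predicates X → Set; the output subsets may live in a
-- higher universe level ℓ (needed because ℙ quantifies over subsets).
record ConsStruct (ℓ : Level) : Set (lsuc ℓ) where
  field
    Carrier : Set
    Cn      : Pred Carrier 0ℓ → Pred Carrier ℓ

open ConsStruct public

Consistent : ∀ {ℓ} (L : ConsStruct ℓ) → Pred (Carrier L) 0ℓ → Set ℓ
Consistent L Γ = ¬ (∀ x → Cn L Γ x)

CnP : ∀ {ℓ} (L : ConsStruct ℓ) → Pred (Carrier L) 0ℓ → Pred (Carrier L) (lsuc 0ℓ ⊔ ℓ)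
CnP L Γ x = Σ (Pred (Carrier L) 0ℓ) λ Γ' → (Γ' ⊆ Γ) × Consistent L Γ' × Cn L Γ' x

𝐏 : ∀ {ℓ} → ConsStruct ℓ → ConsStruct (lsuc 0ℓ ⊔ ℓ)
𝐏 L = record { Carrier = Carrier L ; Cn = CnP L }

PropLetter : Set
PropLetter = ℕ

data For : Set where
  var  : PropLetter → For
  ¬'_  : For → For
  _∨'_ : For → For → For
  _∧'_ : For → For → For
  _⇒'_ : For → For → For

data V3 : Set where
  v0 vh v1 : V3

f¬ : V3 → V3
f¬ v0 = v1
f¬ vh = v0
f¬ v1 = v0

f∨ : V3 → V3 → V3
f∨ v0 y  = y
f∨ vh v0 = vh
f∨ vh vh = vh
f∨ vh v1 = v1
f∨ v1 _  = v1

f∧ : V3 → V3 → V3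
f∧ v0 _  = v0
f∧ vh v0 = v0
f∧ vh vh = vh
f∧ vh v1 = vh
f∧ v1 y  = y

f⇒ : V3 → V3 → V3
f⇒ v0 _  = v1
f⇒ vh v0 = v0
f⇒ vh vh = v1
f⇒ vh v1 = v1
f⇒ v1 y  = y

Valuation : Set
Valuation = PropLetter → V3

⟦_⟧ : For → Valuation → V3
⟦ var p ⟧ v = v p
⟦ ¬' a ⟧ v = f¬ (⟦ a ⟧ v)
⟦ a ∨' b ⟧ v = f∨ (⟦ a ⟧ v) (⟦ b ⟧ v)
⟦ a ∧' b ⟧ v = f∧ (⟦ a ⟧ v) (⟦ b ⟧ v)
⟦ a ⇒' b ⟧ v = f⇒ (⟦ a ⟧ v) (⟦ b ⟧ v)

_⊨G3_ : Pred For 0ℓ → For → Set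
Γ ⊨G3 α = (v : Valuation) → (∀ γ → Γ γ → ⟦ γ ⟧ v ≡ v1) → ⟦ α ⟧ v ≡ v1

CnG3 : Pred For 0ℓ → Pred For 0ℓ
CnG3 Γ α = Γ ⊨G3 α

G3 : ConsStruct 0ℓ
G3 = record { Carrier = For ; Cn = CnG3 }

-- ℙ is idempotent on every monotone consequence structure L, in particular on
-- G₃. A ℙ(L)-consequence of a ℙ(L)-consistent Γ' ⊆ Γ is an L-consequence of
-- some L-consistent Γ'' ⊆ Γ' ⊆ Γ. Conversely, monotonicity gives
-- Cn^ℙ_L(Γ') ⊆ Cn_L(Γ'), so L-consistent sets are ℙ(L)-consistent, and for
-- such Γ' the set Cn_L(Γ') is already contained in Cn^ℙ_L(Γ').
module Submission where

open import Defs
open import Level using (Level; 0ℓ; _⊔_) renaming (suc to lsuc)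
open import Relation.Unary using (Pred; _⊆_)
open import Data.Product using (_×_; _,_)

Monotone : ∀ {ℓ} → ConsStruct ℓ → Set (lsuc 0ℓ ⊔ ℓ)
Monotone L = ∀ {A B : Pred (Carrier L) 0ℓ} → A ⊆ B → Cn L A ⊆ Cn L B

CnG3-monotone : Monotone G3
CnG3-monotone A⊆B A⊨α v v⊨B = A⊨α v (λ γ γ∈A → v⊨B γ (A⊆B γ∈A))

module _ {ℓ : Level} (L : ConsStruct ℓ) where

  CnP⊆Cn : Monotone L → ∀ {Γ} → CnP L Γ ⊆ Cn L Γ
  CnP⊆Cn mono (Γ' , Γ'⊆Γ , _ , x∈CnΓ') = mono Γ'⊆Γ x∈CnΓ'

  consistent⇒𝐏-consistent : Monotone L → ∀ {Γ} → Consistent L Γ → Consistent (𝐏 L) Γ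
  consistent⇒𝐏-consistent mono Γ-consistent CnPΓ-total =
    Γ-consistent (λ x → CnP⊆Cn mono (CnPΓ-total x))

  Cn⊆CnP : ∀ {Γ} → Consistent L Γ → Cn L Γ ⊆ CnP L Γ
  Cn⊆CnP {Γ} Γ-consistent x∈CnΓ = Γ , (λ γ∈Γ → γ∈Γ) , Γ-consistent , x∈CnΓ

  CnP-𝐏⊆CnP : ∀ {Γ} → CnP (𝐏 L) Γ ⊆ CnP L Γ
  CnP-𝐏⊆CnP (Γ' , Γ'⊆Γ , _ , (Γ'' , Γ''⊆Γ' , Γ''-consistent , x∈CnΓ'')) =
    Γ'' , (λ γ∈Γ'' → Γ'⊆Γ (Γ''⊆Γ' γ∈Γ'')) , Γ''-consistent , x∈CnΓ''

  CnP⊆CnP-𝐏 : Monotone L → ∀ {Γ} → CnP L Γ ⊆ CnP (𝐏 L) Γ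
  CnP⊆CnP-𝐏 mono (Γ' , Γ'⊆Γ , Γ'-consistent , x∈CnΓ') =
    Γ' , Γ'⊆Γ , consistent⇒𝐏-consistent mono Γ'-consistent
       , Cn⊆CnP Γ'-consistent x∈CnΓ'

proposition15 : (Γ : Pred For 0ℓ) (α : For) →
    (Cn (𝐏 (𝐏 G3)) Γ α → Cn (𝐏 G3) Γ α) × (Cn (𝐏 G3) Γ α → Cn (𝐏 (𝐏 G3)) Γ α)
proposition15 Γ α = CnP-𝐏⊆CnP G3 {Γ} {α} , CnP⊆CnP-𝐏 G3 CnG3-monotone {Γ} {α}
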